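{- In an optimal (minimum-length feasible) plan for an instance of Unlabeled Pebble Motion on Trees, every pebble travels from its starting node to the target node it ends on along a shortest path (i.e. along the unique simple path in the tree between these two nodes).
   Context: Unlabeled Pebble Motion on Trees: a tree $T=(V,E)$ with $n=|V|$ nodes; $k$ pebbles initially occupy $k$ distinct nodes; $k$ distinct nodes are targets (may coincide with starting nodes), and any pebble may end at any target. A move moves one pebble from its current node to an adjacent pebble-free node; a plan is a sequence of moves, feasible if afterwards every pebble is on a target; its length is the number of moves; an optimal plan is a feasible plan of minimum length. -}

module Defs where

open import Data.Nat using (ℕ; _≤_)
open import Data.Fin using (Fin; _≟_)
open import Data.Product using (_×_; _,_; proj₁; proj₂; Σ; ∃)
open import Data.Sum using (_⊎_)
open import Data.List using (List; []; _∷_; length; map; filter)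
open import Data.List.Membership.Propositional using (_∈_)
open import Data.List.Relation.Unary.Unique.Propositional using (Unique)
open import Relation.Binary.PropositionalEquality using (_≡_; _≢_)
open import Relation.Nullary using (¬_; yes; no)
open import Function.Definitions using (Injective)

-- Graphs on the vertex set Fin n, given by a list of (undirected) edges.

Edges : ℕ → Set
Edges n = List (Fin n × Fin n)

Adj : ∀ {n} → Edges n → Fin n → Fin n → Set
Adj E u v = ((u , v) ∈ E) ⊎ ((v , u) ∈ E)

data Walk {n} (E : Edges n) : Fin n → Fin n → List (Fin n) → Set where
  here : ∀ u → Walk E u u (u ∷ [])
  cons : ∀ {u w v ws} → Adj E u w → Walk E w v ws → Walk E u v (u ∷ ws)

IsPath : ∀ {n} → Edges n → Fin n → Fin n → List (Fin n) → Set
IsPath E u v ws = Walk E u v ws × Unique ws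

HasCycle : ∀ {n} → Edges n → Set
HasCycle {n} E = Σ (Fin n) λ u → Σ (Fin n) λ v → Σ (List (Fin n)) λ ws →
  IsPath E u v ws × Adj E v u × (3 ≤ length ws)

IsTree : ∀ {n} → Edges n → Set
IsTree {n} E =
  (1 ≤ n)
  × (∀ u → ¬ Adj E u u)
  × (∀ u v → ∃ λ ws → IsPath E u v ws)
  × ¬ HasCycle E

-- Pebble motion. k pebbles (labelled 0..k-1 only for bookkeeping);
-- a configuration assigns to each pebble its current node.

Config : ℕ → ℕ → Set
Config k n = Fin k → Fin n

Move : ℕ → ℕ → Set
Move k n = Fin k × Fin n

update : ∀ {k n} → Config k n → Fin k → Fin n → Config k n
update c i v j with j ≟ i
... | yes _ = v
... | no  _ = c j

data Run {k n} (E : Edges n) : Config k n → List (Move k n) → Config k n → Set where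
  done : ∀ {c} → Run E c [] c
  step : ∀ {c i v ms c'} →
         Adj E (c i) v →
         (∀ j → c j ≢ v) →
         Run E (update c i v) ms c' →
         Run E c ((i , v) ∷ ms) c'

Feasible : ∀ {k n} → Edges n → Config k n → (Fin k → Fin n) → List (Move k n) → Set
Feasible {k} {n} E s t ms =
  Σ (Config k n) λ c' → Run E s ms c' × (∀ j → ∃ λ l → c' j ≡ t l)

Optimal : ∀ {k n} → Edges n → Config k n → (Fin k → Fin n) → List (Move k n) → Set
Optimal E s t ms =
  Feasible E s t ms × (∀ ms' → Feasible E s t ms' → length ms ≤ length ms')

trajectory : ∀ {k n} → Config k n → Fin k → List (Move k n) → List (Fin n)
trajectory s i ms = s i ∷ map proj₂ (filter (λ m → proj₁ m ≟ i) ms)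

-- A walk in a tree that is not a simple path contains a backtrack a → b → a, so if some
-- pebble's trajectory is not a path, the pebble makes a move a → b and its next move is
-- b → a. Delete both moves and let the pebble wait at a. Whenever another pebble j moves
-- onto the node where it waits, skip that move and let j take over the waiting pebble's role
-- (pebbles are unlabelled) and charge the saved move to a walk that now leads from j's
-- old position to a. When the original pebble finally returns to a, push the pebbles
-- along that walk, one move per edge. This yields a plan that is strictly shorter and
-- ends in a relabelling of the original final configuration, hence is feasible too.
module Submission where

open import Defs
open import Data.Nat using (ℕ; suc; _+_; _≤_; _<_; z≤n; s≤s)
open import Data.Nat.Properties
  using (module ≤-Reasoning; ≤-trans; ≤-reflexive; n≤1+n; +-comm; +-suc; +-monoˡ-<; <⇒≱)
open import Data.Fin using (Fin; _≟_)
open import Data.Fin.Properties using (any?)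
open import Data.Fin.Permutation
  using (Permutation′; _⟨$⟩ʳ_; _⟨$⟩ˡ_; inverseʳ; id; flip; _∘ₚ_; transpose)
open import Data.Product using (_×_; _,_; proj₁; proj₂; ∃; ∃₂; map₂)
open import Data.Sum using (_⊎_; inj₁; inj₂)
open import Data.Empty using (⊥-elim)
open import Data.List using (List; []; _∷_; length; map; filter; _++_)
open import Data.List.Properties using (length-++)
open import Data.List.Membership.Propositional using (_∈_)
import Data.List.Membership.DecPropositional as DecMembership
open import Data.List.Relation.Unary.Any using (here; there)
open import Data.List.Relation.Unary.All using ([])
open import Data.List.Relation.Unary.All.Properties using (¬Any⇒All¬; ++⁻ˡ)
open import Data.List.Relation.Unary.AllPairs using ([]; _∷_)
open import Data.List.Relation.Unary.Unique.Propositional using (Unique)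
open import Relation.Nullary using (¬_; yes; no)
open import Relation.Binary.PropositionalEquality
open import Function.Base using (_∘_)
open import Function.Bundles using (Injection)
open import Function.Definitions using (Injective)
open import Function.Properties.Inverse using (↔⇒↣)

private variable
  k n : ℕ
  E : Edges n
  c c′ d : Config k n
  i j m : Fin k
  u v p a : Fin n
  ms : List (Move k n)
  ws : List (Fin n)
  L L′ : ℕ
  σ : Permutation′ k

data Backtracks {A : Set} : List A → Set where
  backtrack : ∀ {x y xs} → Backtracks (x ∷ y ∷ x ∷ xs)
  further   : ∀ {x xs} → Backtracks xs → Backtracks (x ∷ xs)

Backtracks-uncons : ∀ {A : Set} {x y : A} {ys} → Backtracks (x ∷ y ∷ ys) →
                    Backtracks (y ∷ ys) ⊎ ∃ λ zs → ys ≡ x ∷ zs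
Backtracks-uncons backtrack    = inj₂ (_ , refl)
Backtracks-uncons (further bt) = inj₁ bt

Unique-++⁻ˡ : ∀ {A : Set} (xs : List A) {ys} → Unique (xs ++ ys) → Unique xs
Unique-++⁻ˡ []       _                = []
Unique-++⁻ˡ (x ∷ xs) (x∉xsys ∷ uniq) = ++⁻ˡ xs x∉xsys ∷ Unique-++⁻ˡ xs uniq

Loopless : Edges n → Set
Loopless E = ∀ u → ¬ Adj E u u

walk-nonempty : Walk E u v ws → 1 ≤ length ws
walk-nonempty (here _)   = s≤s z≤n
walk-nonempty (cons _ _) = s≤s z≤n

walk-prefix : ∀ {x} → Walk E u v ws → x ∈ ws →
              ∃₂ λ pre rest → ws ≡ pre ++ rest × Walk E u x pre
walk-prefix (here u)                (here refl)  = u ∷ [] , [] , refl , here u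
walk-prefix (cons {u = u} _ _)      (here refl)  = u ∷ [] , _ , refl , here u
walk-prefix (cons {u = u} adj walk) (there x∈ws) with walk-prefix walk x∈ws
... | pre , rest , refl , prefix = u ∷ pre , rest , refl , cons adj prefix

walk-unique⊎backtracks : Loopless E → ¬ HasCycle E → Walk E u v ws → Unique ws ⊎ Backtracks ws
walk-unique⊎backtracks _ _ (here _) = inj₁ ([] ∷ [])
walk-unique⊎backtracks loopless acyclic (cons {u = u} {w} {ws = ws} adj walk)
  with walk-unique⊎backtracks loopless acyclic walk
... | inj₂ bt    = inj₂ (further bt)
... | inj₁ uniq with DecMembership._∈?_ _≟_ u ws
...   | no u∉ws   = inj₁ (¬Any⇒All¬ ws u∉ws ∷ uniq)
-- The rest of the walk returns to u, either at once or along a cycle closed by the edge u w.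
...   | yes u∈ws with walk-prefix walk u∈ws
...     | _   , _ , refl , here _                        = ⊥-elim (loopless u adj)
...     | _   , _ , refl , cons _ (here _)               = inj₂ backtrack
...     | pre , _ , refl , cycle@(cons _ (cons _ rest)) =
  ⊥-elim (acyclic (w , u , pre , (cycle , Unique-++⁻ˡ pre uniq) , adj ,
                   s≤s (s≤s (walk-nonempty rest))))

Free : Config k n → Fin n → Set
Free c v = ∀ j → c j ≢ v

update-≡ : ∀ (c : Config k n) i v → update c i v i ≡ v
update-≡ c i v with i ≟ i
... | yes _  = refl
... | no i≢i = ⊥-elim (i≢i refl)

update-≢ : ∀ (c : Config k n) v → j ≢ i → update c i v j ≡ c j
update-≢ {j = j} {i} c v j≢i with j ≟ i
... | yes j≡i = ⊥-elim (j≢i j≡i)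
... | no _    = refl

update-update : ∀ (c : Config k n) i u v → update (update c i u) i v ≗ update c i v
update-update c i u v j with j ≟ i
... | yes refl = refl
... | no j≢i   = update-≢ c u j≢i

update-self : ∀ (c : Config k n) i → c i ≡ v → update c i v ≗ c
update-self c i ci≡v j with j ≟ i
... | yes refl = sym ci≡v
... | no _     = refl

update-comm : ∀ (c : Config k n) → i ≢ j → ∀ u v →
              update (update c i u) j v ≗ update (update c j v) i u
update-comm {i = i} {j} c i≢j u v x with x ≟ i | x ≟ j
... | yes refl | yes refl = ⊥-elim (i≢j refl)
... | yes refl | no _     = update-≡ c x u
... | no _     | yes refl = sym (update-≡ c x v)
... | no x≢i   | no x≢j   = trans (update-≢ c u x≢i) (sym (update-≢ c v x≢j))

update-injective : Injective _≡_ _≡_ c → Free c v → ∀ i → Injective _≡_ _≡_ (update c i v)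
update-injective inj free i {x} {y} eq with x ≟ i | y ≟ i
... | yes x≡i | yes y≡i = trans x≡i (sym y≡i)
... | yes _   | no _    = ⊥-elim (free y (sym eq))
... | no _    | yes _   = ⊥-elim (free x eq)
... | no _    | no _    = inj eq

Free-update : Free c u → v ≢ u → ∀ i → Free (update c i v) u
Free-update free v≢u i j with j ≟ i
... | yes _ = v≢u
... | no _  = free j

Free-vacated : Injective _≡_ _≡_ c → c i ≢ v → Free (update c i v) (c i)
Free-vacated {i = i} inj ci≢v j with j ≟ i
... | yes _  = λ v≡ci → ci≢v (sym v≡ci)
... | no j≢i = λ cj≡ci → j≢i (inj cj≡ci)

record _≈[_]_ (c : Config k n) (π : Permutation′ k) (d : Config k n) : Set where
  constructor relabelled
  field at : ∀ x → d (π ⟨$⟩ʳ x) ≡ c x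
open _≈[_]_

≗⇒≈ : c ≗ d → c ≈[ id ] d
≗⇒≈ c≗d = relabelled λ x → sym (c≗d x)

≈-trans : ∀ {e : Config k n} {π ρ} → c ≈[ π ] d → d ≈[ ρ ] e → c ≈[ π ∘ₚ ρ ] e
≈-trans {π = π} c≈d d≈e = relabelled λ x → trans (at d≈e (π ⟨$⟩ʳ x)) (at c≈d x)

≈-lookup : ∀ {π} → c ≈[ π ] d → ∀ y → d y ≡ c (π ⟨$⟩ˡ y)
≈-lookup {d = d} {π} c≈d y = trans (cong d (sym (inverseʳ π))) (at c≈d (π ⟨$⟩ˡ y))

≈-free : ∀ {π} → c ≈[ π ] d → Free c v → Free d v
≈-free {π = π} c≈d free y dy≡v = free (π ⟨$⟩ˡ y) (trans (sym (≈-lookup c≈d y)) dy≡v)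

≈-injective : ∀ {π} → c ≈[ π ] d → Injective _≡_ _≡_ c → Injective _≡_ _≡_ d
≈-injective {π = π} c≈d inj {x} {y} dx≡dy =
  Injection.injective (↔⇒↣ (flip π))
    (inj (trans (sym (≈-lookup c≈d x)) (trans dx≡dy (≈-lookup c≈d y))))

≈-update : ∀ {π} → c ≈[ π ] d → ∀ i v → update c i v ≈[ π ] update d (π ⟨$⟩ʳ i) v
≈-update {c = c} {d} {π} c≈d i v = relabelled updated
  where
  updated : ∀ x → update d (π ⟨$⟩ʳ i) v (π ⟨$⟩ʳ x) ≡ update c i v x
  updated x with x ≟ i
  ... | yes refl = update-≡ d (π ⟨$⟩ʳ x) v
  ... | no x≢i   = trans (update-≢ d v (x≢i ∘ Injection.injective (↔⇒↣ π))) (at c≈d x)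

≈-transpose : ∀ {c₁ c₂ : Config k n} i j → c₂ i ≡ c₁ j → c₂ j ≡ c₁ i →
              (∀ x → x ≢ i → x ≢ j → c₂ x ≡ c₁ x) → c₁ ≈[ transpose i j ] c₂
≈-transpose {c₁ = c₁} {c₂} i j c₂i≡c₁j c₂j≡c₁i rest = relabelled swapped
  where
  swapped : ∀ x → c₂ (transpose i j ⟨$⟩ʳ x) ≡ c₁ x
  swapped x with x ≟ i
  ... | yes refl = c₂j≡c₁i
  ... | no x≢i with x ≟ j
  ...   | yes refl = c₂i≡c₁j
  ...   | no x≢j   = rest x x≢i x≢j

Run-++ : ∀ {ms₁ ms₂} {c₁ c₂ c₃ : Config k n} →
         Run E c₁ ms₁ c₂ → Run E c₂ ms₂ c₃ → Run E c₁ (ms₁ ++ ms₂) c₃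
Run-++ done          r₂ = r₂
Run-++ (step a f r₁) r₂ = step a f (Run-++ r₁ r₂)

Run-relabel : ∀ {π} → Run E c ms c′ → c ≈[ π ] d →
              ∃₂ λ ms′ d′ → Run E d ms′ d′ × length ms′ ≡ length ms × c′ ≈[ π ] d′
Run-relabel done c≈d = [] , _ , done , refl , c≈d
Run-relabel {E = E} {d = d} {π = π} (step {i = i} {v} adj free r) c≈d
  with Run-relabel r (≈-update c≈d i v)
... | ms′ , d′ , r′ , same-length , c′≈d′ =
  (π ⟨$⟩ʳ i , v) ∷ ms′ , d′ , step adj′ (≈-free c≈d free) r′ , cong suc same-length , c′≈d′
  where
  adj′ : Adj E (d (π ⟨$⟩ʳ i)) v
  adj′ = subst (λ z → Adj E z v) (sym (at c≈d i)) adj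

record Reach (E : Edges n) (c c′ : Config k n) (L : ℕ) : Set where
  constructor reach
  field
    plan        : List (Move k n)
    final       : Config k n
    relabelling : Permutation′ k
    runs        : Run E c plan final
    shorter     : length plan < L
    relabels    : c′ ≈[ relabelling ] final

Reach-mono : L ≤ L′ → Reach E c c′ L → Reach E c c′ L′
Reach-mono L≤L′ (reach ms d π r bound c′≈d) = reach ms d π r (≤-trans bound L≤L′) c′≈d

Reach-here : c i ≡ v → Reach E c (update c i v) (suc L)
Reach-here {c = c} {i} ci≡v = reach [] c id done (s≤s z≤n) (≗⇒≈ (update-self c i ci≡v))

Reach-step : Adj E (c i) v → Free c v → Reach E (update c i v) c′ L → Reach E c c′ (suc L)
Reach-step {i = i} {v} adj free (reach ms d π r bound c′≈d) =
  reach ((i , v) ∷ ms) d π (step adj free r) (s≤s bound) c′≈d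

Reach-relabel : ∀ {c₁ c₂ : Config k n} {π} → c₂ ≈[ π ] c₁ → Reach E c c₁ L → Reach E c c₂ L
Reach-relabel c₂≈c₁ (reach ms d π r bound c₁≈d) = reach ms d _ r bound (≈-trans c₂≈c₁ c₁≈d)

Reach-++ : ∀ {c₁ c₂ : Config k n} → Reach E c c₁ L → Run E c₁ ms c₂ → Reach E c c₂ (length ms + L)
Reach-++ {L = L} {ms = ms} (reach ms₁ d π r bound c₁≈d) r₂ with Run-relabel r₂ c₁≈d
... | ms₂ , d′ , r₂′ , same-length , c₂≈d′ =
  reach (ms₁ ++ ms₂) d′ π (Run-++ r r₂′) shorter c₂≈d′
  where
  open ≤-Reasoning
  shorter : length (ms₁ ++ ms₂) < length ms + L
  shorter = begin-strict
    length (ms₁ ++ ms₂)     ≡⟨ length-++ ms₁ ⟩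
    length ms₁ + length ms₂ <⟨ +-monoˡ-< (length ms₂) bound ⟩
    L + length ms₂          ≡⟨ cong (L +_) same-length ⟩
    L + length ms           ≡⟨ +-comm L (length ms) ⟩
    length ms + L           ∎

-- If the next node w is occupied, first push its pebble on to a and then move m to w;
-- this reaches update d m a with m and the pebble from w exchanged.
push : Loopless E → Injective _≡_ _≡_ d → d m ≡ p → (p ≢ a → Free d a) →
       Walk E p a ws → Reach E d (update d m a) (length ws)
push _ _ dm≡p _ (here _) = Reach-here dm≡p
push {E = E} {d = d} {m} {p} {a} loopless inj dm≡p a-free (cons {w = w} adj walk)
  with p ≟ a | any? (λ j → d j ≟ w)
... | yes refl | _ = Reach-here dm≡p
... | no p≢a | no w-unoccupied =
  Reach-step (subst (λ z → Adj E z w) (sym dm≡p) adj) w-free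
    (Reach-relabel (≗⇒≈ (λ x → sym (update-update d m w a x)))
      (push loopless (update-injective inj w-free m) (update-≡ d m w) w-a-free walk))
  where
  w-free : Free d w
  w-free j dj≡w = w-unoccupied (j , dj≡w)
  w-a-free : w ≢ a → Free (update d m w) a
  w-a-free w≢a = Free-update (a-free p≢a) w≢a m
... | no p≢a | yes (m′ , dm′≡w) =
  Reach-relabel swap
    (Reach-++ (push loopless inj dm′≡w (λ _ → a-free p≢a) walk) (step adj′ w-vacated done))
  where
  m′≢m : m′ ≢ m
  m′≢m refl = loopless p (subst (Adj E p) (trans (sym dm′≡w) dm≡p) adj)
  adj′ : Adj E (update d m′ a m) w
  adj′ = subst (λ z → Adj E z w) (sym (trans (update-≢ d a (m′≢m ∘ sym)) dm≡p)) adj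
  w-vacated : Free (update d m′ a) w
  w-vacated = subst (Free (update d m′ a)) dm′≡w (Free-vacated inj (a-free p≢a m′))
  swap : update d m a ≈[ transpose m m′ ] update (update d m′ a) m w
  swap = ≈-transpose m m′
    (trans (update-≡ _ m w) (trans (sym dm′≡w) (sym (update-≢ d a m′≢m))))
    (trans (update-≢ _ w m′≢m) (trans (update-≡ d m′ a) (sym (update-≡ d m a))))
    (λ x x≢m x≢m′ → trans (update-≢ _ w x≢m) (trans (update-≢ d a x≢m′) (sym (update-≢ d a x≢m))))

destinations : Fin k → List (Move k n) → List (Fin n)
destinations i ms = map proj₂ (filter (λ m → proj₁ m ≟ i) ms)

trajectory-walk : ∀ i → Run E c ms c′ → Walk E (c i) (c′ i) (trajectory c i ms)
trajectory-walk i done = here _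
trajectory-walk {E = E} {c = c} {c′ = c′} i (step {i = j} {v} {ms} adj free r) with j ≟ i
... | yes refl =
  cons adj (subst (λ z → Walk E z (c′ j) (z ∷ destinations j ms)) (update-≡ c j v)
             (trajectory-walk j r))
... | no j≢i =
  subst (λ z → Walk E z (c′ i) (z ∷ destinations i ms)) (update-≢ c v (j≢i ∘ sym))
        (trajectory-walk i r)

data FirstMoveTo (i : Fin k) (a : Fin n) : List (Move k n) → Set where
  first : FirstMoveTo i a ((i , a) ∷ ms)
  later : j ≢ i → FirstMoveTo i a ms → FirstMoveTo i a ((j , v) ∷ ms)

firstMoveTo : ∀ {i : Fin k} ms → destinations i ms ≡ a ∷ ws → FirstMoveTo i a ms
firstMoveTo {i = i} ((j , v) ∷ ms) eq with j ≟ i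
... | yes refl with eq
...   | refl = first
firstMoveTo ((j , v) ∷ ms) eq | no j≢i = later j≢i (firstMoveTo ms eq)

-- The run from c continues a plan whose next move of pebble i is to a; d is the configuration
-- of the shortened plan, a relabelling of c except that i sits at the free node p instead.
-- If another pebble j enters p, the two exchange roles: i now sits at j's old node, the walk
-- gains an edge and the plan loses a move. When i finally moves to a, push along the walk.
cancelExcursion : Loopless E → Run E c ms c′ → FirstMoveTo i a ms →
                  Injective _≡_ _≡_ c → Free c p → update c i p ≈[ σ ] d →
                  Walk E p a ws → Reach E d c′ (length ms + length ws)
cancelExcursion {E = E} {c = c} {i = i} {a} {p = p} {σ = σ} {d = d} {ws = ws}
  loopless (step {ms = ms} adj a-free r) first inj p-free c≈d walk =
  Reach-mono (n≤1+n (length ms + length ws))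
    (Reach-++ (Reach-relabel moved (push loopless d-injective d-at-p a-free′ walk)) r)
  where
  d-injective : Injective _≡_ _≡_ d
  d-injective = ≈-injective c≈d (update-injective inj p-free i)
  d-at-p : d (σ ⟨$⟩ʳ i) ≡ p
  d-at-p = trans (at c≈d i) (update-≡ c i p)
  a-free′ : p ≢ a → Free d a
  a-free′ p≢a = ≈-free c≈d (Free-update a-free p≢a i)
  moved : update c i a ≈[ id ∘ₚ σ ] update d (σ ⟨$⟩ʳ i) a
  moved = ≈-trans (≗⇒≈ (λ x → sym (update-update c i p a x))) (≈-update c≈d i a)
cancelExcursion {E = E} {c = c} {i = i} {p = p} {σ = σ} {d = d} {ws = ws}
  loopless (step {i = j} {v} {ms} adj v-free r) (later j≢i next) inj p-free c≈d walk with v ≟ p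
... | yes refl =
  Reach-mono (≤-reflexive (+-suc (length ms) (length ws)))
    (cancelExcursion loopless r next (update-injective inj v-free j)
      (Free-vacated inj (v-free j)) (≈-trans swap c≈d) (cons adj walk))
  where
  swap : update (update c j p) i (c j) ≈[ transpose i j ] update c i p
  swap = ≈-transpose i j
    (trans (update-≡ c i p) (sym (trans (update-≢ _ (c j) j≢i) (update-≡ c j p))))
    (trans (update-≢ c p j≢i) (sym (update-≡ _ i (c j))))
    (λ x x≢i x≢j → trans (update-≢ c p x≢i) (sym (trans (update-≢ _ (c j) x≢i) (update-≢ c p x≢j))))
... | no v≢p =
  Reach-step adj′ (≈-free c≈d (Free-update v-free (v≢p ∘ sym) i))
    (cancelExcursion loopless r next (update-injective inj v-free j)
      (Free-update p-free v≢p j) (≈-trans commuted (≈-update c≈d j v)) walk)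
  where
  adj′ : Adj E (d (σ ⟨$⟩ʳ j)) v
  adj′ = subst (λ z → Adj E z v) (sym (trans (at c≈d j) (update-≢ c p j≢i))) adj
  commuted : update (update c j v) i p ≈[ id ] update (update c i p) j v
  commuted = ≗⇒≈ (update-comm c j≢i v p)

shortcut : Loopless E → Run E c ms c′ → Injective _≡_ _≡_ c →
           Backtracks (trajectory c i ms) → Reach E c c′ (length ms)
shortcut _ done _ (further ())
shortcut {c = c} {i = i} loopless (step {i = j} {v} {ms} adj free r) inj bt with j ≟ i
... | no j≢i =
  Reach-step adj free (shortcut loopless r (update-injective inj free j)
    (subst (λ z → Backtracks (z ∷ destinations i ms)) (sym (update-≢ c v (j≢i ∘ sym))) bt))
... | yes refl with Backtracks-uncons bt
...   | inj₁ bt′ =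
  Reach-step adj free (shortcut loopless r (update-injective inj free j)
    (subst (λ z → Backtracks (z ∷ destinations j ms)) (sym (update-≡ c j v)) bt′))
...   | inj₂ (_ , returns) =
  Reach-mono (≤-reflexive (+-comm (length ms) 1))
    (cancelExcursion loopless r (firstMoveTo ms returns) (update-injective inj free j)
      (Free-vacated inj (free j)) back (here (c j)))
  where
  back : update (update c j v) j (c j) ≈[ id ] c
  back = ≗⇒≈ (λ x → trans (update-update c j v (c j) x) (update-self c j refl x))

mainTheorem5 : ∀ {n k} (E : Edges n) → IsTree E →
    (s : Config k n) → Injective _≡_ _≡_ s →
    (t : Fin k → Fin n) → Injective _≡_ _≡_ t →
    (ms : List (Move k n)) → Optimal E s t ms →
    ∀ (c' : Config k n) → Run E s ms c' →
    ∀ (i : Fin k) → IsPath E (s i) (c' i) (trajectory s i ms)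
mainTheorem5 E (_ , loopless , _ , acyclic) s s-injective t _ ms
             ((_ , run , on-targets) , optimal) _ run′ i
  with walk-unique⊎backtracks loopless acyclic (trajectory-walk i run)
... | inj₁ unique = trajectory-walk i run′ , unique
... | inj₂ backtracks = ⊥-elim (<⇒≱ shorter (optimal plan (final , runs , final-on-targets)))
  where
  open Reach (shortcut loopless run s-injective backtracks)
  final-on-targets : ∀ j → ∃ λ l → final j ≡ t l
  final-on-targets j = map₂ (trans (≈-lookup relabels j)) (on-targets (relabelling ⟨$⟩ˡ j))
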